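{- Let $d$ be a positive odd integer and $m=(1,1,d,d)$. Then $\theta_m\in D(m)$.
   Context: Let $\mathbb{K}$ be a field of characteristic zero, $S=\mathbb{K}[x,y]$, and $\mathrm{Der}(S)=\{f\partial_x+g\partial_y : f,g\in S\}$, acting on polynomials by $\theta(h)=f\,\partial h/\partial x+g\,\partial h/\partial y$. Put $\alpha_1=x$, $\alpha_2=y$, $\alpha_3=x-y$, $\alpha_4=x+y$. For $m=(m_1,m_2,m_3,m_4)\in\mathbb{Z}_{\ge 0}^4$ let $|m|=\sum m_i$ and $D(m)=\{\theta\in\mathrm{Der}(S):\theta(\alpha_i)\in\alpha_i^{m_i}S\ \text{for all } i\}$. For real $a$ and integer $n\ge0$ let $\langle a\rangle_n=\prod_{j=0}^{n-1}(a+2j)$ (with $\langle a\rangle_0=1$); $n!!$ is the double factorial with $0!!=1$. For $m=(m_1,m_2,m_3,m_3)$ with $m_1,m_2$ odd and $|m|\in4\mathbb{Z}$, let $e=\frac{|m|}{2}-1$ and define $f_m=\sum_{i=0}^{(e-m_1)/2}(-1)^i\frac{\langle m_1+m_2-e\rangle_{(e-m_1)/2-i}}{(e-m_1-2i)!!\,(e-2i)!!\,(2i)!!}x^{e-2i}y^{2i}$, $g_m=\sum_{i=0}^{(e-m_2)/2}(-1)^{i+m_3}\frac{\langle m_1+m_2-e\rangle_{(e-m_2)/2-i}}{(e-m_2-2i)!!\,(e-2i)!!\,(2i)!!}x^{2i}y^{e-2i}$, where a sum with negative upper limit is $0$, and $\theta_m=f_m\partial_x-g_m\partial_y$. (For $m=(1,1,d,d)$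 one has $e=d$.) -}

module Defs where

open import Level using (Level; _⊔_) renaming (suc to lsuc)
open import Algebra.Bundles using (CommutativeRing)
open import Data.Nat as ℕ using (ℕ; zero; suc; _∸_; _/_; _≤ᵇ_)
open import Data.Bool using (if_then_else_)
open import Data.Integer as ℤ using (ℤ; +_; -[1+_])
open import Data.Fin using (Fin; zero; suc)
open import Data.Product using (Σ; ∃; _×_)
open import Relation.Nullary using (¬_)

natR : {c ℓ : Level} (R : CommutativeRing c ℓ) → ℕ → CommutativeRing.Carrier R
natR R zero    = CommutativeRing.0# R
natR R (suc n) = CommutativeRing._+_ R (CommutativeRing.1# R) (natR R n)

record CharZeroField (c ℓ : Level) : Set (lsuc (c ⊔ ℓ)) where
  field
    commutativeRing : CommutativeRing c ℓ
  open CommutativeRing commutativeRing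
  field
    0≉1       : ¬ (0# ≈ 1#)
    inv       : (x : Carrier) → ¬ (x ≈ 0#) → Carrier
    inv-right : (x : Carrier) (p : ¬ (x ≈ 0#)) → x * inv x p ≈ 1#
    charZero  : (n : ℕ) → ¬ (natR commutativeRing (suc n) ≈ 0#)

module Poly {c ℓ : Level} (K : CharZeroField c ℓ) where
  open CharZeroField K
  open CommutativeRing commutativeRing

  ι : ℕ → Carrier
  ι = natR commutativeRing

  ιℤ : ℤ → Carrier
  ιℤ (+ n)    = ι n
  ιℤ -[1+ n ] = - ι (suc n)

  -- 1/n in K for n ≠ 0 (uses characteristic zero); value at 0 is irrelevant
  invNat : ℕ → Carrier
  invNat zero    = 0#
  invNat (suc n) = inv (ι (suc n)) (charZero n)

  -- Polynomials in S = K[x,y], as coefficient functions: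
  -- h i j is the coefficient of x^i y^j.

  Coeffs : Set c
  Coeffs = ℕ → ℕ → Carrier

  IsPoly : Coeffs → Set ℓ
  IsPoly h = ∃ λ N → ∀ i j → N ℕ.≤ i ℕ.+ j → h i j ≈ 0#

  _≋_ : Coeffs → Coeffs → Set ℓ
  p ≋ q = ∀ i j → p i j ≈ q i j

  sumK : ℕ → (ℕ → Carrier) → Carrier
  sumK zero    f = 0#
  sumK (suc n) f = f n + sumK n f

  _⊕_ : Coeffs → Coeffs → Coeffs
  (p ⊕ q) i j = p i j + q i j

  ⊖_ : Coeffs → Coeffs
  (⊖ p) i j = - (p i j)

  _⊖_ : Coeffs → Coeffs → Coeffs
  p ⊖ q = p ⊕ (⊖ q)

  _⊛_ : Coeffs → Coeffs → Coeffs
  (p ⊛ q) a b = sumK (suc a) λ i → sumK (suc b) λ j → p i j * q (a ∸ i) (b ∸ j)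

  mono : Carrier → ℕ → ℕ → Coeffs
  mono k a b i j = if (a ℕ.≡ᵇ i) Data.Bool.∧ (b ℕ.≡ᵇ j) then k else 0#

  zeroP oneP X Y : Coeffs
  zeroP _ _ = 0#
  oneP = mono 1# 0 0
  X = mono 1# 1 0
  Y = mono 1# 0 1

  _^P_ : Coeffs → ℕ → Coeffs
  p ^P zero  = oneP
  p ^P suc k = p ⊛ (p ^P k)

  sumP : ℕ → (ℕ → Coeffs) → Coeffs
  sumP zero    P = zeroP
  sumP (suc n) P = P n ⊕ sumP n P

  ∂x ∂y : Coeffs → Coeffs
  ∂x h i j = ι (suc i) * h (suc i) j
  ∂y h i j = ι (suc j) * h i (suc j)

  record Deriv : Set c where
    constructor _∂x+_∂y
    field
      fcoef gcoef : Coeffs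
  open Deriv public

  InDer : Deriv → Set ℓ
  InDer θ = IsPoly (fcoef θ) × IsPoly (gcoef θ)

  act : Deriv → Coeffs → Coeffs
  act θ h = (fcoef θ ⊛ ∂x h) ⊕ (gcoef θ ⊛ ∂y h)

  InIdealPow : Coeffs → ℕ → Coeffs → Set (c ⊔ ℓ)
  InIdealPow a k h = Σ Coeffs λ q → IsPoly q × (h ≋ ((a ^P k) ⊛ q))

  α : Fin 4 → Coeffs
  α zero                   = X
  α (suc zero)             = Y
  α (suc (suc zero))       = X ⊖ Y
  α (suc (suc (suc zero))) = X ⊕ Y

  InD : (Fin 4 → ℕ) → Deriv → Set (c ⊔ ℓ)
  InD m θ = InDer θ × (∀ i → InIdealPow (α i) (m i) (act θ (α i)))

  poch2 : ℤ → ℕ → ℤ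
  poch2 a zero    = + 1
  poch2 a (suc n) = poch2 a n ℤ.* (a ℤ.+ + (2 ℕ.* n))

  dfact : ℕ → ℕ
  dfact zero          = 1
  dfact (suc zero)    = 1
  dfact (suc (suc n)) = suc (suc n) ℕ.* dfact n

  sgn : ℕ → Carrier
  sgn zero    = 1#
  sgn (suc n) = - sgn n

  eOf : ℕ → ℕ → ℕ → ℕ
  eOf m₁ m₂ m₃ = ((m₁ ℕ.+ m₂ ℕ.+ m₃ ℕ.+ m₃) / 2) ∸ 1

  -- number of terms of Σ_{i=0}^{(e-k)/2}: zero if e < k
  nTerms : ℕ → ℕ → ℕ
  nTerms e k = if k ≤ᵇ e then suc ((e ∸ k) / 2) else 0

  f-m : ℕ → ℕ → ℕ → Coeffs
  f-m m₁ m₂ m₃ = sumP (nTerms e m₁) λ i →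
      mono (sgn i * ιℤ (poch2 a (L ∸ i))
                  * invNat (dfact (e ∸ m₁ ∸ 2 ℕ.* i) ℕ.* dfact (e ∸ 2 ℕ.* i) ℕ.* dfact (2 ℕ.* i)))
           (e ∸ 2 ℕ.* i) (2 ℕ.* i)
    where
      e = eOf m₁ m₂ m₃
      a = + (m₁ ℕ.+ m₂) ℤ.- + e
      L = (e ∸ m₁) / 2

  g-m : ℕ → ℕ → ℕ → Coeffs
  g-m m₁ m₂ m₃ = sumP (nTerms e m₂) λ i →
      mono (sgn (i ℕ.+ m₃) * ιℤ (poch2 a (L ∸ i))
                  * invNat (dfact (e ∸ m₂ ∸ 2 ℕ.* i) ℕ.* dfact (e ∸ 2 ℕ.* i) ℕ.* dfact (2 ℕ.* i)))
           (2 ℕ.* i) (e ∸ 2 ℕ.* i)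
    where
      e = eOf m₁ m₂ m₃
      a = + (m₁ ℕ.+ m₂) ℤ.- + e
      L = (e ∸ m₂) / 2

  θ-m : ℕ → ℕ → ℕ → Deriv
  θ-m m₁ m₂ m₃ = f-m m₁ m₂ m₃ ∂x+ (⊖ g-m m₁ m₂ m₃) ∂y

  mvec : ℕ → ℕ → ℕ → ℕ → Fin 4 → ℕ
  mvec m₁ m₂ m₃ m₄ zero                   = m₁
  mvec m₁ m₂ m₃ m₄ (suc zero)             = m₂
  mvec m₁ m₂ m₃ m₄ (suc (suc zero))       = m₃
  mvec m₁ m₂ m₃ m₄ (suc (suc (suc zero))) = m₄

module Submission where

-- Write d = 2L + 1 and B(a, b) for the coefficient of x^a y^b in (x + y)^d. With
-- c = (-1)^L (2L - 1)!! / d!, the defining formula gives f_m = c Σ_k B(d - 2k, 2k) x^(d-2k) y^(2k),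
-- the part of c (x + y)^d that is odd in x, and -g_m = the part of c (x + y)^d that is odd in y.
-- Hence θ_m(x) = f_m ∈ xS, θ_m(y) = -g_m ∈ yS, and θ_m(x ∓ y) = f_m ± g_m = c (x ∓ y)^d.

open import Defs
open import Level using (Level)
open import Data.Nat using (ℕ; _%_)
open import Relation.Binary.PropositionalEquality using (_≡_)

open import Algebra.Bundles using (CommutativeRing)
open import Data.Nat as ℕ using (zero; suc; _∸_; _!)
import Data.Nat.Properties as ℕ
open import Data.Integer as ℤ using (+_; -[1+_])
open import Data.Bool using (true; false; _∧_; if_then_else_)
open import Data.Bool.Properties using (∧-comm; ∧-zeroʳ)
open import Data.Product using (_,_)
import Data.Fin as Fin
open import Function using (_∘_)
open import Relation.Nullary using (yes; no)
open import Relation.Nullary.Decidable using (dec-true; dec-false)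
import Relation.Binary.PropositionalEquality as ≡
open ≡ using (_≢_)

-- dfact and poch2 are defined inside Poly, hence the parameter K.
module Arithmetic {c ℓ : Level} (K : CharZeroField c ℓ) where

  open import Data.Nat
  open import Data.Nat.Properties
  open import Data.Nat.Tactic.RingSolver using (solve-∀)
  open import Data.Integer as ℤ using (ℤ; +_)
  import Data.Integer.Properties as ℤ
  import Data.Integer.Tactic.RingSolver as ℤ
  open import Relation.Nullary using (yes; no; contradiction)
  open import Function using (_∘_)
  open import Relation.Binary.PropositionalEquality
  open ≡-Reasoning
  open import Data.Nat.DivMod using (m*n/n≡m; m≡m%n+[m/n]*n)
  open Poly K using (dfact; poch2; eOf)

  data ParityView : ℕ → Set where
    even : ∀ k → ParityView (2 * k)
    odd  : ∀ k → ParityView (suc (2 * k))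

  parityView : ∀ n → ParityView n
  parityView zero = even 0
  parityView (suc n) with parityView n
  ... | even k = odd k
  ... | odd k  = subst ParityView (*-suc 2 k) (even (suc k))

  data OddDegreeShape (L : ℕ) : ℕ → ℕ → Set where
    oddEven   : ∀ r k → r + k ≡ L → OddDegreeShape L (suc (2 * r)) (2 * k)
    evenOdd   : ∀ r k → r + k ≡ L → OddDegreeShape L (2 * r) (suc (2 * k))
    offDegree : ∀ {i j} → i + j ≢ suc (2 * L) → OddDegreeShape L i j

  oddDegreeShape : ∀ L i j → OddDegreeShape L i j
  oddDegreeShape L i j with parityView i | parityView j
  ... | even r | even k = offDegree λ e → even≢odd (r + k) L (trans (*-distribˡ-+ 2 r k) e)
  ... | odd r  | odd k  = offDegree λ e → even≢odd (suc (r + k)) L (trans (lemma r k) e)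
    where
    lemma : ∀ r k → 2 * suc (r + k) ≡ suc (2 * r) + suc (2 * k)
    lemma = solve-∀
  ... | odd r  | even k with r + k ≟ L
  ...   | yes r+k≡L = oddEven r k r+k≡L
  ...   | no r+k≢L  = offDegree λ e → r+k≢L (*-cancelˡ-≡ _ _ 2 (suc-injective (trans (lemma r k) e)))
    where
    lemma : ∀ r k → suc (2 * (r + k)) ≡ suc (2 * r) + 2 * k
    lemma = solve-∀
  oddDegreeShape L i j | even r | odd k with r + k ≟ L
  ...   | yes r+k≡L = evenOdd r k r+k≡L
  ...   | no r+k≢L  = offDegree λ e → r+k≢L (*-cancelˡ-≡ _ _ 2 (suc-injective (trans (lemma r k) e)))
    where
    lemma : ∀ r k → suc (2 * (r + k)) ≡ 2 * r + suc (2 * k)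
    lemma = solve-∀

  odd∸even : ∀ {k L} → k ≤ L → suc (2 * L) ∸ 2 * k ≡ suc (2 * (L ∸ k))
  odd∸even {k} {L} k≤L = begin
    suc (2 * L) ∸ 2 * k   ≡⟨ +-∸-assoc 1 (*-monoʳ-≤ 2 k≤L) ⟩
    suc (2 * L ∸ 2 * k)   ≡⟨ cong suc (*-distribˡ-∸ 2 L k) ⟨
    suc (2 * (L ∸ k))     ∎

  -- binomial₂ d a b is the coefficient of x^a y^b in (x + y)^d.
  binomial₂ : ℕ → ℕ → ℕ → ℕ
  binomial₂ zero    zero    zero    = 1
  binomial₂ zero    zero    (suc b) = 0
  binomial₂ zero    (suc a) b       = 0
  binomial₂ (suc d) zero    zero    = 0
  binomial₂ (suc d) (suc a) zero    = binomial₂ d a zero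
  binomial₂ (suc d) zero    (suc b) = binomial₂ d zero b
  binomial₂ (suc d) (suc a) (suc b) = binomial₂ d a (suc b) + binomial₂ d (suc a) b

  binomial₂-comm : ∀ d a b → binomial₂ d a b ≡ binomial₂ d b a
  binomial₂-comm zero    zero    zero    = refl
  binomial₂-comm zero    zero    (suc b) = refl
  binomial₂-comm zero    (suc a) zero    = refl
  binomial₂-comm zero    (suc a) (suc b) = refl
  binomial₂-comm (suc d) zero    zero    = refl
  binomial₂-comm (suc d) (suc a) zero    = binomial₂-comm d a zero
  binomial₂-comm (suc d) zero    (suc b) = binomial₂-comm d zero b
  binomial₂-comm (suc d) (suc a) (suc b) =
    trans (cong₂ _+_ (binomial₂-comm d a (suc b)) (binomial₂-comm d (suc a) b))
          (+-comm (binomial₂ d (suc b) a) (binomial₂ d b (suc a)))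

  binomial₂-offDegree : ∀ d a b → a + b ≢ d → binomial₂ d a b ≡ 0
  binomial₂-offDegree zero    zero    zero    a+b≢d = contradiction refl a+b≢d
  binomial₂-offDegree zero    zero    (suc b) a+b≢d = refl
  binomial₂-offDegree zero    (suc a) b       a+b≢d = refl
  binomial₂-offDegree (suc d) zero    zero    a+b≢d = refl
  binomial₂-offDegree (suc d) (suc a) zero    a+b≢d =
    binomial₂-offDegree d a zero (a+b≢d ∘ cong suc)
  binomial₂-offDegree (suc d) zero    (suc b) a+b≢d =
    binomial₂-offDegree d zero b (a+b≢d ∘ cong suc)
  binomial₂-offDegree (suc d) (suc a) (suc b) a+b≢d = cong₂ _+_
    (binomial₂-offDegree d a (suc b) (a+b≢d ∘ cong suc))
    (binomial₂-offDegree d (suc a) b (a+b≢d ∘ cong suc ∘ trans (+-suc a b)))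

  binomial₂*a!*b!≡d! : ∀ d a b → a + b ≡ d → binomial₂ d a b * (a ! * b !) ≡ d !
  binomial₂*a!*b!≡d! zero    zero    zero    refl = refl
  binomial₂*a!*b!≡d! (suc d) (suc a) zero    a+0≡d = begin
    binomial₂ d a 0 * (suc a * a ! * 1)   ≡⟨ lemma (binomial₂ d a 0) (a !) a ⟩
    suc a * (binomial₂ d a 0 * (a ! * 1)) ≡⟨ cong (suc a *_) (binomial₂*a!*b!≡d! d a zero (suc-injective a+0≡d)) ⟩
    suc a * d !                           ≡⟨ cong (λ n → suc n * d !) a≡d ⟩
    suc d !                               ∎
    where
    a≡d : a ≡ d
    a≡d = trans (sym (+-identityʳ a)) (suc-injective a+0≡d)
    lemma : ∀ p x a → p * (suc a * x * 1) ≡ suc a * (p * (x * 1))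
    lemma = solve-∀
  binomial₂*a!*b!≡d! (suc d) zero    (suc b) refl = begin
    binomial₂ d 0 b * (1 * (suc b * b !)) ≡⟨ lemma (binomial₂ d 0 b) (b !) b ⟩
    suc b * (binomial₂ d 0 b * (1 * b !)) ≡⟨ cong (suc b *_) (binomial₂*a!*b!≡d! d zero b refl) ⟩
    suc d !                               ∎
    where
    lemma : ∀ p x b → p * (1 * (suc b * x)) ≡ suc b * (p * (1 * x))
    lemma = solve-∀
  binomial₂*a!*b!≡d! (suc d) (suc a) (suc b) a+b≡d = begin
    (p + q) * (suc a ! * suc b !)
      ≡⟨ lemma p q (a !) (b !) a b ⟩
    suc a * (p * (a ! * suc b !)) + suc b * (q * (suc a ! * b !))
      ≡⟨ cong₂ (λ u v → suc a * u + suc b * v)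
               (binomial₂*a!*b!≡d! d a (suc b) a+1+b≡d)
               (binomial₂*a!*b!≡d! d (suc a) b (trans (sym (+-suc a b)) a+1+b≡d)) ⟩
    suc a * d ! + suc b * d !
      ≡⟨ *-distribʳ-+ (d !) (suc a) (suc b) ⟨
    (suc a + suc b) * d !
      ≡⟨ cong (_* d !) a+b≡d ⟩
    suc d !
      ∎
    where
    p q : ℕ
    p = binomial₂ d a (suc b)
    q = binomial₂ d (suc a) b
    a+1+b≡d : a + suc b ≡ d
    a+1+b≡d = suc-injective a+b≡d
    lemma : ∀ p q x y a b → (p + q) * (suc a * x * (suc b * y))
                          ≡ suc a * (p * (x * (suc b * y))) + suc b * (q * (suc a * x * y))
    lemma = solve-∀

  *-pos : ∀ {m n} → 0 < m → 0 < n → 0 < m * n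
  *-pos {suc m} {suc n} _ _ = s≤s z≤n

  oddDescending : ℕ → ℕ → ℕ
  oddDescending L zero    = 1
  oddDescending L (suc n) = oddDescending L n * (2 * L ∸ 1 ∸ 2 * n)

  signed : ℕ → ℤ → ℤ
  signed zero    z = z
  signed (suc n) z = ℤ.- signed n z

  signed-* : ∀ n z w → signed n z ℤ.* w ≡ signed n (z ℤ.* w)
  signed-* zero    z w = refl
  signed-* (suc n) z w = trans (sym (ℤ.neg-distribˡ-* (signed n z) w)) (cong ℤ.-_ (signed-* n z w))

  2[1+n+t]∸1∸2n≡1+2t : ∀ n t → 2 * suc (n + t) ∸ 1 ∸ 2 * n ≡ suc (2 * t)
  2[1+n+t]∸1∸2n≡1+2t n t = begin
    2 * suc (n + t) ∸ 1 ∸ 2 * n   ≡⟨ cong (λ m → m ∸ 1 ∸ 2 * n) (*-suc 2 (n + t)) ⟩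
    suc (2 * (n + t)) ∸ 2 * n     ≡⟨ cong (_∸ 2 * n) (lemma n t) ⟩
    2 * n + suc (2 * t) ∸ 2 * n   ≡⟨ m+n∸m≡n (2 * n) (suc (2 * t)) ⟩
    suc (2 * t)                   ∎
    where
    lemma : ∀ n t → suc (2 * (n + t)) ≡ 2 * n + suc (2 * t)
    lemma = solve-∀

  -- The factors of ⟨2 - (2L + 1)⟩_n are -(2L - 1), -(2L - 3), ...
  2-odd+even≡-odd : ∀ {n L} → n < L → + 2 ℤ.- + suc (2 * L) ℤ.+ + (2 * n) ≡ ℤ.- + (2 * L ∸ 1 ∸ 2 * n)
  2-odd+even≡-odd {n} {L} n<L =
    subst (λ L → + 2 ℤ.- + suc (2 * L) ℤ.+ + (2 * n) ≡ ℤ.- + (2 * L ∸ 1 ∸ 2 * n))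
          (m+[n∸m]≡n n<L) (split (L ∸ suc n))
    where
    split : ∀ t → + 2 ℤ.- + suc (2 * suc (n + t)) ℤ.+ + (2 * n) ≡ ℤ.- + (2 * suc (n + t) ∸ 1 ∸ 2 * n)
    split t = begin
      + 2 ℤ.- + suc (2 * suc (n + t)) ℤ.+ + (2 * n)
        ≡⟨ cong (λ m → + 2 ℤ.- m ℤ.+ + (2 * n)) (cong +_ (ℕ-split n t)) ⟩
      + 2 ℤ.- + (2 + (2 * n + suc (2 * t))) ℤ.+ + (2 * n)
        ≡⟨ cong (λ m → + 2 ℤ.- m ℤ.+ + (2 * n)) (trans (ℤ.pos-+ 2 _) (cong (ℤ._+_ (+ 2)) (ℤ.pos-+ (2 * n) _))) ⟩
      + 2 ℤ.- (+ 2 ℤ.+ (+ (2 * n) ℤ.+ + suc (2 * t))) ℤ.+ + (2 * n)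
        ≡⟨ ℤ-cancel (+ (2 * n)) (+ suc (2 * t)) ⟩
      ℤ.- + suc (2 * t)
        ≡⟨ cong (λ m → ℤ.- + m) (2[1+n+t]∸1∸2n≡1+2t n t) ⟨
      ℤ.- + (2 * suc (n + t) ∸ 1 ∸ 2 * n)
        ∎
      where
      ℕ-split : ∀ n t → suc (2 * suc (n + t)) ≡ 2 + (2 * n + suc (2 * t))
      ℕ-split = solve-∀
      ℤ-cancel : ∀ x y → + 2 ℤ.- (+ 2 ℤ.+ (x ℤ.+ y)) ℤ.+ x ≡ ℤ.- y
      ℤ-cancel = ℤ.solve-∀

  [1+n]!≡n!!*[1+n]!! : ∀ n → suc n ! ≡ dfact n * dfact (suc n)
  [1+n]!≡n!!*[1+n]!! zero    = refl
  [1+n]!≡n!!*[1+n]!! (suc n) =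
    trans (cong (suc (suc n) *_) ([1+n]!≡n!!*[1+n]!! n)) (lemma n (dfact n) (dfact (suc n)))
    where
    lemma : ∀ m a b → suc (suc m) * (a * b) ≡ b * (suc (suc m) * a)
    lemma = solve-∀

  n!≡[n∸1]!!*n!! : ∀ n → n ! ≡ dfact (n ∸ 1) * dfact n
  n!≡[n∸1]!!*n!! zero    = refl
  n!≡[n∸1]!!*n!! (suc n) = [1+n]!≡n!!*[1+n]!! n

  dfact-pos : ∀ n → 0 < dfact n
  dfact-pos zero          = s≤s z≤n
  dfact-pos (suc zero)    = s≤s z≤n
  dfact-pos (suc (suc n)) = *-pos {suc (suc n)} (s≤s z≤n) (dfact-pos n)

  dfact[1+2k] : ∀ k → dfact (suc (2 * k)) ≡ suc (2 * k) * dfact (2 * k ∸ 1)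
  dfact[1+2k] zero    = refl
  dfact[1+2k] (suc k) = subst (λ m → dfact (suc m) ≡ suc m * dfact (m ∸ 1)) (sym (*-suc 2 k)) refl

  oddDescending-split : ∀ {L} r k → r + k ≡ L → oddDescending L L ≡ oddDescending L r * dfact (2 * k ∸ 1)
  oddDescending-split {L} r zero    r+0≡L =
    trans (cong (oddDescending L) (trans (sym r+0≡L) (+-identityʳ r))) (sym (*-identityʳ _))
  oddDescending-split {L} r (suc k) r+1+k≡L = begin
    oddDescending L L
      ≡⟨ oddDescending-split (suc r) k (trans (sym (+-suc r k)) r+1+k≡L) ⟩
    oddDescending L r * (2 * L ∸ 1 ∸ 2 * r) * dfact (2 * k ∸ 1)
      ≡⟨ *-assoc (oddDescending L r) _ _ ⟩
    oddDescending L r * ((2 * L ∸ 1 ∸ 2 * r) * dfact (2 * k ∸ 1))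
      ≡⟨ cong (λ n → oddDescending L r * (n * dfact (2 * k ∸ 1))) gap ⟩
    oddDescending L r * (suc (2 * k) * dfact (2 * k ∸ 1))
      ≡⟨ cong (oddDescending L r *_) (trans (sym (dfact[1+2k] k)) (cong (λ n → dfact (n ∸ 1)) (sym (*-suc 2 k)))) ⟩
    oddDescending L r * dfact (2 * suc k ∸ 1)
      ∎
    where
    gap : 2 * L ∸ 1 ∸ 2 * r ≡ suc (2 * k)
    gap = subst (λ L → 2 * L ∸ 1 ∸ 2 * r ≡ suc (2 * k))
                  (trans (sym (+-suc r k)) r+1+k≡L) (2[1+n+t]∸1∸2n≡1+2t r k)

  poch2[2-odd]≡signed : ∀ {L} n → n ≤ L → poch2 (+ 2 ℤ.- + suc (2 * L)) n ≡ signed n (+ oddDescending L n)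
  poch2[2-odd]≡signed zero    _         = refl
  poch2[2-odd]≡signed {L} (suc n) 1+n≤L = begin
    poch2 A n ℤ.* (A ℤ.+ + (2 * n))
      ≡⟨ cong₂ ℤ._*_ (poch2[2-odd]≡signed n (<⇒≤ 1+n≤L)) (2-odd+even≡-odd 1+n≤L) ⟩
    signed n (+ oddDescending L n) ℤ.* ℤ.- + (2 * L ∸ 1 ∸ 2 * n)
      ≡⟨ ℤ.neg-distribʳ-* (signed n _) _ ⟨
    ℤ.- (signed n (+ oddDescending L n) ℤ.* + (2 * L ∸ 1 ∸ 2 * n))
      ≡⟨ cong ℤ.-_ (signed-* n _ _) ⟩
    ℤ.- signed n (+ oddDescending L n ℤ.* + (2 * L ∸ 1 ∸ 2 * n))
      ≡⟨ cong (ℤ.-_ ∘ signed n) (ℤ.pos-* (oddDescending L n) _) ⟨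
    signed (suc n) (+ oddDescending L (suc n))
      ∎
    where
    A : ℤ
    A = + 2 ℤ.- + suc (2 * L)

  dfact-triple-reindex : ∀ r k → let d = suc (2 * (r + k)) in
                  dfact (d ∸ 1 ∸ 2 * k) * dfact (d ∸ 2 * k) * dfact (2 * k)
                  ≡ dfact (2 * r) * dfact (suc (2 * r)) * dfact (2 * k)
  dfact-triple-reindex r k = cong₂ (λ a b → dfact a * dfact b * dfact (2 * k)) even-gap odd-gap
    where
    even-gap : 2 * (r + k) ∸ 2 * k ≡ 2 * r
    even-gap = trans (sym (*-distribˡ-∸ 2 (r + k) k)) (cong (2 *_) (m+n∸n≡m r k))
    odd-gap : suc (2 * (r + k)) ∸ 2 * k ≡ suc (2 * r)
    odd-gap = trans (odd∸even (m≤n+m k r)) (cong (λ n → suc (2 * n)) (m+n∸n≡m r k))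

  binomial₂-cross-multiplied : ∀ r k → let L = r + k in
                   oddDescending L r * suc (2 * L) !
                   ≡ binomial₂ (suc (2 * L)) (suc (2 * r)) (2 * k) * oddDescending L L
                     * (dfact (2 * r) * dfact (suc (2 * r)) * dfact (2 * k))
  binomial₂-cross-multiplied r k = begin
    q * suc (2 * L) !
      ≡⟨ cong (q *_) (binomial₂*a!*b!≡d! (suc (2 * L)) (suc (2 * r)) (2 * k) (cong suc (sym (*-distribˡ-+ 2 r k)))) ⟨
    q * (B * (suc (2 * r) ! * (2 * k) !))
      ≡⟨ cong (λ n → q * (B * n)) (cong₂ _*_ ([1+n]!≡n!!*[1+n]!! (2 * r)) (n!≡[n∸1]!!*n!! (2 * k))) ⟩
    q * (B * (dfact (2 * r) * dfact (suc (2 * r)) * (dfact (2 * k ∸ 1) * dfact (2 * k))))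
      ≡⟨ lemma q B (dfact (2 * r)) (dfact (suc (2 * r))) (dfact (2 * k ∸ 1)) (dfact (2 * k)) ⟩
    B * (q * dfact (2 * k ∸ 1)) * (dfact (2 * r) * dfact (suc (2 * r)) * dfact (2 * k))
      ≡⟨ cong (λ n → B * n * (dfact (2 * r) * dfact (suc (2 * r)) * dfact (2 * k))) (oddDescending-split r k refl) ⟨
    B * oddDescending L L * (dfact (2 * r) * dfact (suc (2 * r)) * dfact (2 * k))
      ∎
    where
    L q B : ℕ
    L = r + k
    q = oddDescending L r
    B = binomial₂ (suc (2 * L)) (suc (2 * r)) (2 * k)
    lemma : ∀ q B a b c e → q * (B * (a * b * (c * e))) ≡ B * (q * c) * (a * b * e)
    lemma = solve-∀

  eOf-odd : ∀ L → eOf 1 1 (suc (2 * L)) ≡ suc (2 * L)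
  eOf-odd L = cong (_∸ 1) (trans (cong (_/ 2) (lemma L)) (m*n/n≡m (suc (suc (2 * L))) 2))
    where
    lemma : ∀ L → 1 + 1 + suc (2 * L) + suc (2 * L) ≡ suc (suc (2 * L)) * 2
    lemma = solve-∀

  2n/2≡n : ∀ n → 2 * n / 2 ≡ n
  2n/2≡n n = trans (cong (_/ 2) (*-comm 2 n)) (m*n/n≡m n 2)

  odd≡1+2[n/2] : ∀ {n} → n % 2 ≡ 1 → n ≡ suc (2 * (n / 2))
  odd≡1+2[n/2] {n} n%2≡1 = begin
    n                   ≡⟨ m≡m%n+[m/n]*n n 2 ⟩
    n % 2 + n / 2 * 2   ≡⟨ cong₂ _+_ n%2≡1 (*-comm (n / 2) 2) ⟩
    suc (2 * (n / 2))   ∎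

module _ {c ℓ : Level} (K : CharZeroField c ℓ) where
  open CharZeroField K
  open CommutativeRing commutativeRing
  open Poly K
  open Arithmetic K
  open import Algebra.Properties.Ring ring
    using (-‿distribˡ-*; -‿distribʳ-*; -0#≈0#; -‿involutive; -‿+-comm; -1*x≈-x)
  open import Algebra.Properties.CommutativeSemigroup +-commutativeSemigroup using (interchange)
  open import Algebra.Solver.Ring.NaturalCoefficients.Default commutativeSemiring
  open import Relation.Binary.Reasoning.Setoid setoid

  ι-+ : ∀ m n → ι (m ℕ.+ n) ≈ ι m + ι n
  ι-+ zero    n = sym (+-identityˡ _)
  ι-+ (suc m) n = trans (+-cong refl (ι-+ m n)) (sym (+-assoc _ _ _))

  ι-* : ∀ m n → ι (m ℕ.* n) ≈ ι m * ι n
  ι-* zero    n = sym (zeroˡ _)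
  ι-* (suc m) n = begin
    ι (n ℕ.+ m ℕ.* n)      ≈⟨ ι-+ n (m ℕ.* n) ⟩
    ι n + ι (m ℕ.* n)      ≈⟨ +-cong (sym (*-identityˡ _)) (ι-* m n) ⟩
    1# * ι n + ι m * ι n   ≈⟨ distribʳ _ _ _ ⟨
    ι (suc m) * ι n        ∎

  ι1≈1 : ι 1 ≈ 1#
  ι1≈1 = +-identityʳ 1#

  ιℤ-neg : ∀ z → ιℤ (ℤ.- z) ≈ - ιℤ z
  ιℤ-neg (+ zero)  = sym -0#≈0#
  ιℤ-neg (+ suc n) = refl
  ιℤ-neg -[1+ n ]  = sym (-‿involutive _)

  ιℤ-signed : ∀ n m → ιℤ (signed n (+ m)) ≈ sgn n * ι m
  ιℤ-signed zero    m = sym (*-identityˡ _)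
  ιℤ-signed (suc n) m = trans (ιℤ-neg (signed n (+ m))) (trans (-‿cong (ιℤ-signed n m)) (-‿distribˡ-* _ _))

  sgn-+ : ∀ a b → sgn (a ℕ.+ b) ≈ sgn a * sgn b
  sgn-+ zero    b = sym (*-identityˡ _)
  sgn-+ (suc a) b = trans (-‿cong (sgn-+ a b)) (-‿distribˡ-* _ _)

  sgn-even : ∀ k → sgn (2 ℕ.* k) ≈ 1#
  sgn-even zero    = refl
  sgn-even (suc k) = trans (reflexive (≡.cong sgn (ℕ.*-suc 2 k))) (trans (-‿involutive _) (sgn-even k))

  sgn-odd : ∀ k → sgn (suc (2 ℕ.* k)) ≈ - 1#
  sgn-odd k = -‿cong (sgn-even k)

  ι*invNat-cross : ∀ x y A B → 0 ℕ.< A → 0 ℕ.< B → x ℕ.* B ≡ y ℕ.* A → ι x * invNat A ≈ ι y * invNat B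
  ι*invNat-cross x y (suc A) (suc B) _ _ xB≡yA = begin
    ι x * a⁻¹                      ≈⟨ *-identityʳ _ ⟨
    ι x * a⁻¹ * 1#                 ≈⟨ *-cong refl (inv-right _ (charZero B)) ⟨
    ι x * a⁻¹ * (ι (suc B) * b⁻¹)  ≈⟨ swap (ι x) a⁻¹ (ι (suc B)) b⁻¹ ⟩
    ι x * ι (suc B) * a⁻¹ * b⁻¹    ≈⟨ *-cong (*-cong (ι-* x (suc B)) refl) refl ⟨
    ι (x ℕ.* suc B) * a⁻¹ * b⁻¹    ≈⟨ reflexive (≡.cong (λ n → ι n * a⁻¹ * b⁻¹) xB≡yA) ⟩
    ι (y ℕ.* suc A) * a⁻¹ * b⁻¹    ≈⟨ *-cong (*-cong (ι-* y (suc A)) refl) refl ⟩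
    ι y * ι (suc A) * a⁻¹ * b⁻¹    ≈⟨ *-cong (*-assoc _ _ _) refl ⟩
    ι y * (ι (suc A) * a⁻¹) * b⁻¹  ≈⟨ *-cong (*-cong refl (inv-right _ (charZero A))) refl ⟩
    ι y * 1# * b⁻¹                 ≈⟨ *-cong (*-identityʳ _) refl ⟩
    ι y * b⁻¹                      ∎
    where
    a⁻¹ b⁻¹ : Carrier
    a⁻¹ = invNat (suc A)
    b⁻¹ = invNat (suc B)
    swap : ∀ a b c d → a * b * (c * d) ≈ a * c * b * d
    swap = solve 4 (λ a b c d → a :* b :* (c :* d) := a :* c :* b :* d) refl

  ≡0⇒*≈0 : ∀ {x y} → x ≡ 0# → x * y ≈ 0#
  ≡0⇒*≈0 x≡0 = trans (*-cong (reflexive x≡0) refl) (zeroˡ _)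

  *≡0⇒≈0 : ∀ {x y} → y ≡ 0# → x * y ≈ 0#
  *≡0⇒≈0 y≡0 = trans (*-cong refl (reflexive y≡0)) (zeroʳ _)

  sumK-cong : ∀ n {f g : ℕ → Carrier} → (∀ i → i ℕ.< n → f i ≈ g i) → sumK n f ≈ sumK n g
  sumK-cong zero    f≈g = refl
  sumK-cong (suc n) f≈g = +-cong (f≈g n ℕ.≤-refl) (sumK-cong n λ i i<n → f≈g i (ℕ.m<n⇒m<1+n i<n))

  sumK-zero : ∀ n (f : ℕ → Carrier) → (∀ i → i ℕ.< n → f i ≈ 0#) → sumK n f ≈ 0#
  sumK-zero zero    f f≈0 = refl
  sumK-zero (suc n) f f≈0 =
    trans (+-cong (f≈0 n ℕ.≤-refl) (sumK-zero n f λ i i<n → f≈0 i (ℕ.m<n⇒m<1+n i<n))) (+-identityˡ 0#)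

  sumK-single : ∀ n (f : ℕ → Carrier) u → u ℕ.< n → (∀ i → i ℕ.< n → i ≢ u → f i ≈ 0#) → sumK n f ≈ f u
  sumK-single (suc n) f u u<1+n f≈0 with u ℕ.≟ n
  ... | yes ≡.refl =
    trans (+-cong refl (sumK-zero n f λ i i<n → f≈0 i (ℕ.m<n⇒m<1+n i<n) (ℕ.<⇒≢ i<n))) (+-identityʳ (f u))
  ... | no u≢n =
    trans (+-cong (f≈0 n ℕ.≤-refl (u≢n ∘ ≡.sym))
                  (sumK-single n f u (ℕ.≤∧≢⇒< (ℕ.≤-pred u<1+n) u≢n) λ i i<n → f≈0 i (ℕ.m<n⇒m<1+n i<n)))
          (+-identityˡ (f u))

  sumK-+ : ∀ n (f g : ℕ → Carrier) → sumK n (λ i → f i + g i) ≈ sumK n f + sumK n g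
  sumK-+ zero    f g = sym (+-identityˡ 0#)
  sumK-+ (suc n) f g = trans (+-cong refl (sumK-+ n f g)) (interchange (f n) (g n) (sumK n f) (sumK n g))

  sumK-neg : ∀ n (f : ℕ → Carrier) → sumK n (λ i → - f i) ≈ - sumK n f
  sumK-neg zero    f = sym -0#≈0#
  sumK-neg (suc n) f = trans (+-cong refl (sumK-neg n f)) (-‿+-comm (f n) (sumK n f))

  sumP-pointwise : ∀ n (P : ℕ → Coeffs) i j → sumP n P i j ≡ sumK n (λ k → P k i j)
  sumP-pointwise zero    P i j = ≡.refl
  sumP-pointwise (suc n) P i j = ≡.cong (_+_ (P n i j)) (sumP-pointwise n P i j)

  ≋-refl : ∀ {p} → p ≋ p
  ≋-refl i j = refl

  ≋-trans : ∀ {p q r} → p ≋ q → q ≋ r → p ≋ r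
  ≋-trans p≋q q≋r i j = trans (p≋q i j) (q≋r i j)

  ⊕-cong : ∀ {p p′ q q′} → p ≋ p′ → q ≋ q′ → (p ⊕ q) ≋ (p′ ⊕ q′)
  ⊕-cong p≋p′ q≋q′ i j = +-cong (p≋p′ i j) (q≋q′ i j)

  ⊖-cong : ∀ {p q} → p ≋ q → (⊖ p) ≋ (⊖ q)
  ⊖-cong p≋q i j = -‿cong (p≋q i j)

  IsPoly-≋ : ∀ {p q} → p ≋ q → IsPoly q → IsPoly p
  IsPoly-≋ p≋q (N , q≈0) = N , λ i j N≤i+j → trans (p≋q i j) (q≈0 i j N≤i+j)

  _ᵀ : Coeffs → Coeffs
  (p ᵀ) i j = p j i

  IsPoly-ᵀ : ∀ {p} → IsPoly p → IsPoly (p ᵀ)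
  IsPoly-ᵀ (N , p≈0) = N , λ i j N≤i+j → p≈0 j i (≡.subst (N ℕ.≤_) (ℕ.+-comm i j) N≤i+j)

  mono-same : ∀ k a b → mono k a b a b ≡ k
  mono-same k a b rewrite dec-true (a ℕ.≟ a) ≡.refl | dec-true (b ℕ.≟ b) ≡.refl = ≡.refl

  mono-missˣ : ∀ k a b i j → a ≢ i → mono k a b i j ≡ 0#
  mono-missˣ k a b i j a≢i rewrite dec-false (a ℕ.≟ i) a≢i = ≡.refl

  mono-missʸ : ∀ k a b i j → b ≢ j → mono k a b i j ≡ 0#
  mono-missʸ k a b i j b≢j rewrite dec-false (b ℕ.≟ j) b≢j | ∧-zeroʳ (a ℕ.≡ᵇ i) = ≡.refl

  mono-transpose : ∀ k a b i j → mono k a b i j ≡ mono k b a j i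
  mono-transpose k a b i j = ≡.cong (λ t → if t then k else 0#) (∧-comm (a ℕ.≡ᵇ i) (b ℕ.≡ᵇ j))

  mono-cong : ∀ {k k′} a b i j → k ≈ k′ → mono k a b i j ≈ mono k′ a b i j
  mono-cong a b i j k≈k′ with (a ℕ.≡ᵇ i) ∧ (b ℕ.≡ᵇ j)
  ... | true  = k≈k′
  ... | false = refl

  mono-neg : ∀ k a b i j → mono (- k) a b i j ≈ - mono k a b i j
  mono-neg k a b i j with (a ℕ.≡ᵇ i) ∧ (b ℕ.≡ᵇ j)
  ... | true  = refl
  ... | false = sym -0#≈0#

  ⊛-cong : ∀ {p p′ q q′} → p ≋ p′ → q ≋ q′ → (p ⊛ q) ≋ (p′ ⊛ q′)
  ⊛-cong p≋p′ q≋q′ a b =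
    sumK-cong (suc a) λ i _ → sumK-cong (suc b) λ j _ → *-cong (p≋p′ i j) (q≋q′ (a ∸ i) (b ∸ j))

  ⊛-distribʳ-⊕ : ∀ p p′ q → ((p ⊕ p′) ⊛ q) ≋ ((p ⊛ q) ⊕ (p′ ⊛ q))
  ⊛-distribʳ-⊕ p p′ q a b = begin
    sumK (suc a) (λ i → sumK (suc b) λ j → (p i j + p′ i j) * q (a ∸ i) (b ∸ j))
      ≈⟨ sumK-cong (suc a) (λ i _ → sumK-cong (suc b) λ j _ → distribʳ _ _ _) ⟩
    sumK (suc a) (λ i → sumK (suc b) λ j → P i j + P′ i j)
      ≈⟨ sumK-cong (suc a) (λ i _ → sumK-+ (suc b) (P i) (P′ i)) ⟩
    sumK (suc a) (λ i → sumK (suc b) (P i) + sumK (suc b) (P′ i))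
      ≈⟨ sumK-+ (suc a) (λ i → sumK (suc b) (P i)) (λ i → sumK (suc b) (P′ i)) ⟩
    (p ⊛ q) a b + (p′ ⊛ q) a b
      ∎
    where
    P P′ : ℕ → ℕ → Carrier
    P  i j = p i j * q (a ∸ i) (b ∸ j)
    P′ i j = p′ i j * q (a ∸ i) (b ∸ j)

  ⊛-distribˡ-⊕ : ∀ p q q′ → (p ⊛ (q ⊕ q′)) ≋ ((p ⊛ q) ⊕ (p ⊛ q′))
  ⊛-distribˡ-⊕ p q q′ a b = begin
    sumK (suc a) (λ i → sumK (suc b) λ j → p i j * (q (a ∸ i) (b ∸ j) + q′ (a ∸ i) (b ∸ j)))
      ≈⟨ sumK-cong (suc a) (λ i _ → sumK-cong (suc b) λ j _ → distribˡ _ _ _) ⟩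
    sumK (suc a) (λ i → sumK (suc b) λ j → P i j + P′ i j)
      ≈⟨ sumK-cong (suc a) (λ i _ → sumK-+ (suc b) (P i) (P′ i)) ⟩
    sumK (suc a) (λ i → sumK (suc b) (P i) + sumK (suc b) (P′ i))
      ≈⟨ sumK-+ (suc a) (λ i → sumK (suc b) (P i)) (λ i → sumK (suc b) (P′ i)) ⟩
    (p ⊛ q) a b + (p ⊛ q′) a b
      ∎
    where
    P P′ : ℕ → ℕ → Carrier
    P  i j = p i j * q (a ∸ i) (b ∸ j)
    P′ i j = p i j * q′ (a ∸ i) (b ∸ j)

  ⊛-negate : ∀ {p q p′ q′} → (∀ i j i′ j′ → p i j * q i′ j′ ≈ - (p′ i j * q′ i′ j′)) →
             (p ⊛ q) ≋ (⊖ (p′ ⊛ q′))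
  ⊛-negate {p′ = p′} {q′} pq≈-p′q′ a b =
    trans (sumK-cong (suc a) λ i _ →
             trans (sumK-cong (suc b) λ j _ → pq≈-p′q′ i j (a ∸ i) (b ∸ j))
                   (sumK-neg (suc b) λ j → p′ i j * q′ (a ∸ i) (b ∸ j)))
          (sumK-neg (suc a) λ i → sumK (suc b) λ j → p′ i j * q′ (a ∸ i) (b ∸ j))

  ⊛-negˡ : ∀ p q → ((⊖ p) ⊛ q) ≋ (⊖ (p ⊛ q))
  ⊛-negˡ p q = ⊛-negate {p′ = p} {q} λ _ _ _ _ → sym (-‿distribˡ-* _ _)

  ⊛-negʳ : ∀ p q → (p ⊛ (⊖ q)) ≋ (⊖ (p ⊛ q))
  ⊛-negʳ p q = ⊛-negate {p′ = p} {q} λ _ _ _ _ → sym (-‿distribʳ-* _ _)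

  ⊛-zeroʳ : ∀ p → (p ⊛ zeroP) ≋ zeroP
  ⊛-zeroʳ p a b = sumK-zero (suc a) _ λ i _ → sumK-zero (suc b) _ λ j _ → zeroʳ _

  ⊛-constʳ : ∀ p k → (p ⊛ mono k 0 0) ≋ (λ a b → p a b * k)
  ⊛-constʳ p k a b = begin
    (p ⊛ mono k 0 0) a b
      ≈⟨ sumK-single (suc a) _ a ℕ.≤-refl (λ i i≤a i≢a →
           sumK-zero (suc b) _ λ j _ → *≡0⇒≈0 (mono-missˣ k 0 0 (a ∸ i) (b ∸ j) (∸≢0 i≤a i≢a ∘ ≡.sym))) ⟩
    sumK (suc b) (λ j → p a j * mono k 0 0 (a ∸ a) (b ∸ j))
      ≈⟨ sumK-single (suc b) _ b ℕ.≤-refl (λ j j≤b j≢b →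
           *≡0⇒≈0 (mono-missʸ k 0 0 (a ∸ a) (b ∸ j) (∸≢0 j≤b j≢b ∘ ≡.sym))) ⟩
    p a b * mono k 0 0 (a ∸ a) (b ∸ b)
      ≈⟨ *-cong refl (reflexive (≡.cong₂ (mono k 0 0) (ℕ.n∸n≡0 a) (ℕ.n∸n≡0 b))) ⟩
    p a b * k
      ∎
    where
    ∸≢0 : ∀ {i n} → i ℕ.< suc n → i ≢ n → n ∸ i ≢ 0
    ∸≢0 i<1+n i≢n = ℕ.m>n⇒m∸n≢0 (ℕ.≤∧≢⇒< (ℕ.≤-pred i<1+n) i≢n)

  ⊛-identityʳ : ∀ p → (p ⊛ oneP) ≋ p
  ⊛-identityʳ p a b = trans (⊛-constʳ p 1# a b) (*-identityʳ _)

  shiftˣ shiftʸ : Coeffs → Coeffs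
  shiftˣ p zero    b = 0#
  shiftˣ p (suc a) b = p a b
  shiftʸ p a zero    = 0#
  shiftʸ p a (suc b) = p a b

  X⊛ : ∀ p → (X ⊛ p) ≋ shiftˣ p
  X⊛ p zero    b = trans (+-identityʳ _) (sumK-zero (suc b) _ λ j _ → zeroˡ _)
  X⊛ p (suc a) b = begin
    (X ⊛ p) (suc a) b
      ≈⟨ sumK-single (suc (suc a)) _ 1 (ℕ.s≤s (ℕ.s≤s ℕ.z≤n)) (λ i _ i≢1 →
           sumK-zero (suc b) _ λ j _ → ≡0⇒*≈0 (mono-missˣ 1# 1 0 i j (i≢1 ∘ ≡.sym))) ⟩
    sumK (suc b) (λ j → X 1 j * p a (b ∸ j))
      ≈⟨ sumK-single (suc b) _ 0 (ℕ.s≤s ℕ.z≤n) (λ j _ j≢0 → ≡0⇒*≈0 (mono-missʸ 1# 1 0 1 j (j≢0 ∘ ≡.sym))) ⟩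
    1# * p a b
      ≈⟨ *-identityˡ _ ⟩
    p a b
      ∎

  Y⊛ : ∀ p → (Y ⊛ p) ≋ shiftʸ p
  Y⊛ p a zero    = sumK-zero (suc a) _ λ i _ → trans (+-identityʳ _) (≡0⇒*≈0 (mono-missʸ 1# 0 1 i 0 λ ()))
  Y⊛ p a (suc b) = begin
    (Y ⊛ p) a (suc b)
      ≈⟨ sumK-single (suc a) _ 0 (ℕ.s≤s ℕ.z≤n) (λ i _ i≢0 →
           sumK-zero (suc (suc b)) _ λ j _ → ≡0⇒*≈0 (mono-missˣ 1# 0 1 i j (i≢0 ∘ ≡.sym))) ⟩
    sumK (suc (suc b)) (λ j → Y 0 j * p a (suc b ∸ j))
      ≈⟨ sumK-single (suc (suc b)) _ 1 (ℕ.s≤s (ℕ.s≤s ℕ.z≤n)) (λ j _ j≢1 →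
           ≡0⇒*≈0 (mono-missʸ 1# 0 1 0 j (j≢1 ∘ ≡.sym))) ⟩
    1# * p a b
      ≈⟨ *-identityˡ _ ⟩
    p a b
      ∎

  ∂x-⊕ : ∀ p q → ∂x (p ⊕ q) ≋ (∂x p ⊕ ∂x q)
  ∂x-⊕ p q i j = distribˡ _ _ _

  ∂y-⊕ : ∀ p q → ∂y (p ⊕ q) ≋ (∂y p ⊕ ∂y q)
  ∂y-⊕ p q i j = distribˡ _ _ _

  ∂x-⊖ : ∀ p → ∂x (⊖ p) ≋ (⊖ ∂x p)
  ∂x-⊖ p i j = sym (-‿distribʳ-* _ _)

  ∂y-⊖ : ∀ p → ∂y (⊖ p) ≋ (⊖ ∂y p)
  ∂y-⊖ p i j = sym (-‿distribʳ-* _ _)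

  ∂x-X : ∂x X ≋ oneP
  ∂x-X zero    zero    = trans (*-identityʳ _) ι1≈1
  ∂x-X zero    (suc j) = zeroʳ _
  ∂x-X (suc i) j       = zeroʳ _

  ∂y-X : ∂y X ≋ zeroP
  ∂y-X i j = *≡0⇒≈0 (mono-missʸ 1# 1 0 i (suc j) λ ())

  ∂x-Y : ∂x Y ≋ zeroP
  ∂x-Y i j = *≡0⇒≈0 (mono-missˣ 1# 0 1 (suc i) j λ ())

  ∂y-Y : ∂y Y ≋ oneP
  ∂y-Y zero    zero    = trans (*-identityʳ _) ι1≈1
  ∂y-Y zero    (suc j) = zeroʳ _
  ∂y-Y (suc i) j       = zeroʳ _

  act-⊕ : ∀ θ p q → act θ (p ⊕ q) ≋ (act θ p ⊕ act θ q)
  act-⊕ (F ∂x+ G ∂y) p q a b = begin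
    (F ⊛ ∂x (p ⊕ q)) a b + (G ⊛ ∂y (p ⊕ q)) a b
      ≈⟨ +-cong (⊛-cong {F} ≋-refl (∂x-⊕ p q) a b) (⊛-cong {G} ≋-refl (∂y-⊕ p q) a b) ⟩
    (F ⊛ (∂x p ⊕ ∂x q)) a b + (G ⊛ (∂y p ⊕ ∂y q)) a b
      ≈⟨ +-cong (⊛-distribˡ-⊕ F (∂x p) (∂x q) a b) (⊛-distribˡ-⊕ G (∂y p) (∂y q) a b) ⟩
    ((F ⊛ ∂x p) a b + (F ⊛ ∂x q) a b) + ((G ⊛ ∂y p) a b + (G ⊛ ∂y q) a b)
      ≈⟨ interchange _ _ _ _ ⟩
    act (F ∂x+ G ∂y) p a b + act (F ∂x+ G ∂y) q a b
      ∎

  act-⊖ : ∀ θ p → act θ (⊖ p) ≋ (⊖ act θ p)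
  act-⊖ (F ∂x+ G ∂y) p a b = begin
    (F ⊛ ∂x (⊖ p)) a b + (G ⊛ ∂y (⊖ p)) a b
      ≈⟨ +-cong (⊛-cong {F} ≋-refl (∂x-⊖ p) a b) (⊛-cong {G} ≋-refl (∂y-⊖ p) a b) ⟩
    (F ⊛ (⊖ ∂x p)) a b + (G ⊛ (⊖ ∂y p)) a b
      ≈⟨ +-cong (⊛-negʳ F (∂x p) a b) (⊛-negʳ G (∂y p) a b) ⟩
    - (F ⊛ ∂x p) a b + - (G ⊛ ∂y p) a b
      ≈⟨ -‿+-comm _ _ ⟩
    - act (F ∂x+ G ∂y) p a b
      ∎

  act-X : ∀ F G → act (F ∂x+ G ∂y) X ≋ F
  act-X F G a b = trans (+-cong (trans (⊛-cong {F} ≋-refl ∂x-X a b) (⊛-identityʳ F a b))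
                                (trans (⊛-cong {G} ≋-refl ∂y-X a b) (⊛-zeroʳ G a b)))
                        (+-identityʳ _)

  act-Y : ∀ F G → act (F ∂x+ G ∂y) Y ≋ G
  act-Y F G a b = trans (+-cong (trans (⊛-cong {F} ≋-refl ∂x-Y a b) (⊛-zeroʳ F a b))
                                (trans (⊛-cong {G} ≋-refl ∂y-Y a b) (⊛-identityʳ G a b)))
                        (+-identityˡ _)

  [X⊕Y]^P≋binomial₂ : ∀ d → ((X ⊕ Y) ^P d) ≋ (λ a b → ι (binomial₂ d a b))
  [X⊕Y]^P≋binomial₂ zero    zero    zero    = sym ι1≈1
  [X⊕Y]^P≋binomial₂ zero    zero    (suc b) = refl
  [X⊕Y]^P≋binomial₂ zero    (suc a) b       = refl
  [X⊕Y]^P≋binomial₂ (suc d) a b = begin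
    ((X ⊕ Y) ⊛ ((X ⊕ Y) ^P d)) a b      ≈⟨ ⊛-cong {X ⊕ Y} ≋-refl ([X⊕Y]^P≋binomial₂ d) a b ⟩
    ((X ⊕ Y) ⊛ B) a b                    ≈⟨ ⊛-distribʳ-⊕ X Y B a b ⟩
    (X ⊛ B) a b + (Y ⊛ B) a b            ≈⟨ +-cong (X⊛ B a b) (Y⊛ B a b) ⟩
    shiftˣ B a b + shiftʸ B a b          ≈⟨ pascal a b ⟩
    ι (binomial₂ (suc d) a b)            ∎
    where
    B : Coeffs
    B a b = ι (binomial₂ d a b)
    pascal : ∀ a b → shiftˣ B a b + shiftʸ B a b ≈ ι (binomial₂ (suc d) a b)
    pascal zero    zero    = +-identityʳ _
    pascal (suc a) zero    = +-identityʳ _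
    pascal zero    (suc b) = +-identityˡ _
    pascal (suc a) (suc b) = sym (ι-+ (binomial₂ d a (suc b)) (binomial₂ d (suc a) b))

  [X⊖Y]^P≋±binomial₂ : ∀ d → ((X ⊖ Y) ^P d) ≋ (λ a b → sgn b * ι (binomial₂ d a b))
  [X⊖Y]^P≋±binomial₂ zero    zero    zero    = sym (trans (*-identityˡ _) ι1≈1)
  [X⊖Y]^P≋±binomial₂ zero    zero    (suc b) = sym (zeroʳ _)
  [X⊖Y]^P≋±binomial₂ zero    (suc a) b       = sym (zeroʳ _)
  [X⊖Y]^P≋±binomial₂ (suc d) a b = begin
    ((X ⊖ Y) ⊛ ((X ⊖ Y) ^P d)) a b      ≈⟨ ⊛-cong {X ⊖ Y} ≋-refl ([X⊖Y]^P≋±binomial₂ d) a b ⟩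
    ((X ⊖ Y) ⊛ B) a b                    ≈⟨ ⊛-distribʳ-⊕ X (⊖ Y) B a b ⟩
    (X ⊛ B) a b + ((⊖ Y) ⊛ B) a b        ≈⟨ +-cong (X⊛ B a b) (trans (⊛-negˡ Y B a b) (-‿cong (Y⊛ B a b))) ⟩
    shiftˣ B a b + - shiftʸ B a b        ≈⟨ pascal a b ⟩
    sgn b * ι (binomial₂ (suc d) a b)    ∎
    where
    B : Coeffs
    B a b = sgn b * ι (binomial₂ d a b)
    pascal : ∀ a b → shiftˣ B a b + - shiftʸ B a b ≈ sgn b * ι (binomial₂ (suc d) a b)
    pascal zero    zero    = trans (+-identityˡ _) (trans -0#≈0# (sym (zeroʳ _)))
    pascal (suc a) zero    = trans (+-cong refl -0#≈0#) (+-identityʳ _)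
    pascal zero    (suc b) = trans (+-identityˡ _) (-‿distribˡ-* _ _)
    pascal (suc a) (suc b) = begin
      sgn (suc b) * ι (binomial₂ d a (suc b)) + - (sgn b * ι (binomial₂ d (suc a) b))
        ≈⟨ +-cong refl (-‿distribˡ-* _ _) ⟩
      sgn (suc b) * ι (binomial₂ d a (suc b)) + sgn (suc b) * ι (binomial₂ d (suc a) b)
        ≈⟨ distribˡ _ _ _ ⟨
      sgn (suc b) * (ι (binomial₂ d a (suc b)) + ι (binomial₂ d (suc a) b))
        ≈⟨ *-cong refl (ι-+ (binomial₂ d a (suc b)) (binomial₂ d (suc a) b)) ⟨
      sgn (suc b) * ι (binomial₂ (suc d) (suc a) (suc b))
        ∎

  X-divides : ∀ {h} → IsPoly h → (∀ j → h 0 j ≈ 0#) → InIdealPow X 1 h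
  X-divides {h} (N , h≈0) h₀≈0 = q , (N , λ i j N≤i+j → h≈0 (suc i) j (ℕ.m≤n⇒m≤1+n N≤i+j)) , h≋Xq
    where
    q : Coeffs
    q a b = h (suc a) b
    unshift : ∀ a b → shiftˣ q a b ≈ h a b
    unshift zero    b = sym (h₀≈0 b)
    unshift (suc a) b = refl
    h≋Xq : h ≋ ((X ^P 1) ⊛ q)
    h≋Xq a b = sym (trans (⊛-cong {q = q} (⊛-identityʳ X) ≋-refl a b) (trans (X⊛ q a b) (unshift a b)))

  Y-divides : ∀ {h} → IsPoly h → (∀ i → h i 0 ≈ 0#) → InIdealPow Y 1 h
  Y-divides {h} (N , h≈0) h₀≈0 = q , (N , q≈0) , h≋Yq
    where
    q : Coeffs
    q a b = h a (suc b)
    q≈0 : ∀ i j → N ℕ.≤ i ℕ.+ j → q i j ≈ 0#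
    q≈0 i j N≤i+j = h≈0 i (suc j) (ℕ.≤-trans N≤i+j (ℕ.+-monoʳ-≤ i (ℕ.n≤1+n j)))
    unshift : ∀ a b → shiftʸ q a b ≈ h a b
    unshift a zero    = sym (h₀≈0 a)
    unshift a (suc b) = refl
    h≋Yq : h ≋ ((Y ^P 1) ⊛ q)
    h≋Yq a b = sym (trans (⊛-cong {q = q} (⊛-identityʳ Y) ≋-refl a b) (trans (Y⊛ q a b) (unshift a b)))

  constant-multiple : ∀ {h} p k n → h ≋ ((p ^P n) ⊛ mono k 0 0) → InIdealPow p n h
  constant-multiple p k n h≋ = mono k 0 0 , (1 , constant-isPoly) , h≋
    where
    constant-isPoly : ∀ i j → 1 ℕ.≤ i ℕ.+ j → mono k 0 0 i j ≈ 0#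
    constant-isPoly zero    (suc j) _ = refl
    constant-isPoly (suc i) j       _ = refl

  InD-1-1-d-d : ∀ d k {F G} → IsPoly F → IsPoly G → (∀ j → F 0 j ≈ 0#) → (∀ i → G i 0 ≈ 0#) →
                (F ⊖ G) ≋ (((X ⊖ Y) ^P d) ⊛ mono k 0 0) → (F ⊕ G) ≋ (((X ⊕ Y) ^P d) ⊛ mono k 0 0) →
                InD (mvec 1 1 d d) (F ∂x+ G ∂y)
  InD-1-1-d-d d k {F} {G} F-poly G-poly F₀≈0 G₀≈0 F⊖G≋ F⊕G≋ = (F-poly , G-poly) , divisible
    where
    θ : Deriv
    θ = F ∂x+ G ∂y
    act-X⊖Y : act θ (X ⊖ Y) ≋ (F ⊖ G)
    act-X⊖Y = ≋-trans (act-⊕ θ X (⊖ Y)) (⊕-cong (act-X F G) (≋-trans (act-⊖ θ Y) (⊖-cong (act-Y F G))))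
    act-X⊕Y : act θ (X ⊕ Y) ≋ (F ⊕ G)
    act-X⊕Y = ≋-trans (act-⊕ θ X Y) (⊕-cong (act-X F G) (act-Y F G))
    divisible : ∀ i → InIdealPow (α i) (mvec 1 1 d d i) (act θ (α i))
    divisible Fin.zero =
      X-divides (IsPoly-≋ (act-X F G) F-poly) λ j → trans (act-X F G 0 j) (F₀≈0 j)
    divisible (Fin.suc Fin.zero) =
      Y-divides (IsPoly-≋ (act-Y F G) G-poly) λ i → trans (act-Y F G i 0) (G₀≈0 i)
    divisible (Fin.suc (Fin.suc Fin.zero)) =
      constant-multiple (X ⊖ Y) k d (≋-trans act-X⊖Y F⊖G≋)
    divisible (Fin.suc (Fin.suc (Fin.suc Fin.zero))) =
      constant-multiple (X ⊕ Y) k d (≋-trans act-X⊕Y F⊕G≋)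

  antidiagonal : ℕ → (ℕ → Carrier) → Coeffs
  antidiagonal L w i j = sumK (suc L) λ k → mono (w k) (suc (2 ℕ.* L) ∸ 2 ℕ.* k) (2 ℕ.* k) i j

  antidiagonal-vanish : ∀ L w i j → (∀ k → k ℕ.≤ L → suc (2 ℕ.* (L ∸ k)) ≡ i → 2 ℕ.* k ≢ j) →
                        antidiagonal L w i j ≈ 0#
  antidiagonal-vanish L w i j miss = sumK-zero (suc L) _ λ k k<1+L → reflexive (term k (ℕ.≤-pred k<1+L))
    where
    term : ∀ k → k ℕ.≤ L → mono (w k) (suc (2 ℕ.* L) ∸ 2 ℕ.* k) (2 ℕ.* k) i j ≡ 0#
    term k k≤L with suc (2 ℕ.* L) ∸ 2 ℕ.* k ℕ.≟ i
    ... | yes e = mono-missʸ (w k) (suc (2 ℕ.* L) ∸ 2 ℕ.* k) (2 ℕ.* k) i j (miss k k≤L (≡.trans (≡.sym (odd∸even k≤L)) e))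
    ... | no ne = mono-missˣ (w k) (suc (2 ℕ.* L) ∸ 2 ℕ.* k) (2 ℕ.* k) i j ne

  antidiagonal-evenˣ : ∀ L w r j → antidiagonal L w (2 ℕ.* r) j ≈ 0#
  antidiagonal-evenˣ L w r j = antidiagonal-vanish L w _ j λ k _ e _ → ℕ.even≢odd r (L ∸ k) (≡.sym e)

  antidiagonal-offDegree : ∀ L w i j → i ℕ.+ j ≢ suc (2 ℕ.* L) → antidiagonal L w i j ≈ 0#
  antidiagonal-offDegree L w i j i+j≢d = antidiagonal-vanish L w i j λ k k≤L e₁ e₂ →
    i+j≢d (≡.trans (≡.sym (≡.cong₂ ℕ._+_ e₁ e₂))
            (≡.cong suc (≡.trans (≡.sym (ℕ.*-distribˡ-+ 2 (L ∸ k) k)) (≡.cong (2 ℕ.*_) (ℕ.m∸n+n≡m k≤L)))))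

  antidiagonal-oddˣ-evenʸ : ∀ {L} w r k → r ℕ.+ k ≡ L → antidiagonal L w (suc (2 ℕ.* r)) (2 ℕ.* k) ≈ w k
  antidiagonal-oddˣ-evenʸ w r k ≡.refl =
    trans (sumK-single (suc (r ℕ.+ k)) _ k (ℕ.s≤s (ℕ.m≤n+m k r)) λ k′ _ k′≢k →
             reflexive (mono-missʸ (w k′) (suc (2 ℕ.* (r ℕ.+ k)) ∸ 2 ℕ.* k′) _ (suc (2 ℕ.* r)) (2 ℕ.* k) (k′≢k ∘ ℕ.*-cancelˡ-≡ k′ k 2)))
          (reflexive (≡.trans (≡.cong (λ a → mono (w k) a (2 ℕ.* k) (suc (2 ℕ.* r)) (2 ℕ.* k)) exponent)
                              (mono-same (w k) (suc (2 ℕ.* r)) (2 ℕ.* k))))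
    where
    exponent : suc (2 ℕ.* (r ℕ.+ k)) ∸ 2 ℕ.* k ≡ suc (2 ℕ.* r)
    exponent = ≡.trans (odd∸even (ℕ.m≤n+m k r)) (≡.cong (λ n → suc (2 ℕ.* n)) (ℕ.m+n∸n≡m r k))

  antidiagonal-isPoly : ∀ L w → IsPoly (antidiagonal L w)
  antidiagonal-isPoly L w = suc (suc (2 ℕ.* L)) , λ i j d<i+j →
    antidiagonal-offDegree L w i j (ℕ.<⇒≢ d<i+j ∘ ≡.sym)

  -- With m = (1, 1, d, d) and d = 2L + 1 one has e = d; θ-coeff L k is the coefficient of
  -- x^(d-2k) y^(2k) in f_m.
  θ-coeff : ℕ → ℕ → Carrier
  θ-coeff L k = sgn k * ιℤ (poch2 (+ 2 ℤ.- + d) (L ∸ k))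
                * invNat (dfact (d ∸ 1 ∸ 2 ℕ.* k) ℕ.* dfact (d ∸ 2 ℕ.* k) ℕ.* dfact (2 ℕ.* k))
    where
    d : ℕ
    d = suc (2 ℕ.* L)

  θ-scale : ℕ → Carrier
  θ-scale L = sgn L * ι (oddDescending L L) * invNat (suc (2 ℕ.* L) !)

  θ-coeff-binomial : ∀ {L} r k → r ℕ.+ k ≡ L →
                     θ-coeff L k ≈ ι (binomial₂ (suc (2 ℕ.* L)) (suc (2 ℕ.* r)) (2 ℕ.* k)) * θ-scale L
  θ-coeff-binomial r k ≡.refl = begin
    sgn k * ιℤ (poch2 (+ 2 ℤ.- + d) (L ∸ k)) * invNat D
      ≈⟨ *-cong (*-cong refl numerator) (reflexive (≡.cong invNat (dfact-triple-reindex r k))) ⟩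
    sgn k * (sgn r * ι q) * invNat D′
      ≈⟨ regroup (sgn k) (sgn r) (ι q) (invNat D′) ⟩
    sgn r * sgn k * (ι q * invNat D′)
      ≈⟨ *-cong (sym (sgn-+ r k)) (ι*invNat-cross q (B ℕ.* Q) D′ (d !) D′-pos (ℕ.1≤n! d) (binomial₂-cross-multiplied r k)) ⟩
    sgn L * (ι (B ℕ.* Q) * invNat (d !))
      ≈⟨ *-cong refl (*-cong (ι-* B Q) refl) ⟩
    sgn L * (ι B * ι Q * invNat (d !))
      ≈⟨ regroup′ (sgn L) (ι B) (ι Q) (invNat (d !)) ⟩
    ι B * θ-scale L
      ∎
    where
    L d q Q B D D′ : ℕ
    L = r ℕ.+ k
    d = suc (2 ℕ.* L)
    q = oddDescending L r
    Q = oddDescending L L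
    B = binomial₂ d (suc (2 ℕ.* r)) (2 ℕ.* k)
    D = dfact (d ∸ 1 ∸ 2 ℕ.* k) ℕ.* dfact (d ∸ 2 ℕ.* k) ℕ.* dfact (2 ℕ.* k)
    D′ = dfact (2 ℕ.* r) ℕ.* dfact (suc (2 ℕ.* r)) ℕ.* dfact (2 ℕ.* k)
    D′-pos : 0 ℕ.< D′
    D′-pos = *-pos (*-pos (dfact-pos (2 ℕ.* r)) (dfact-pos (suc (2 ℕ.* r)))) (dfact-pos (2 ℕ.* k))
    numerator : ιℤ (poch2 (+ 2 ℤ.- + d) (L ∸ k)) ≈ sgn r * ι q
    numerator = trans (reflexive (≡.cong ιℤ (≡.trans (≡.cong (poch2 _) (ℕ.m+n∸n≡m r k))
                                                      (poch2[2-odd]≡signed r (ℕ.m≤m+n r k)))))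
                      (ιℤ-signed r q)
    regroup : ∀ a b c d → a * (b * c) * d ≈ b * a * (c * d)
    regroup = solve 4 (λ a b c d → a :* (b :* c) :* d := b :* a :* (c :* d)) refl
    regroup′ : ∀ s b q i → s * (b * q * i) ≈ b * (s * q * i)
    regroup′ = solve 4 (λ s b q i → s :* (b :* q :* i) := b :* (s :* q :* i)) refl

  f-m≋antidiagonal : ∀ L → f-m 1 1 (suc (2 ℕ.* L)) ≋ antidiagonal L (θ-coeff L)
  f-m≋antidiagonal L i j = reflexive (≡.trans (≡.cong (λ p → p i j) unfold) (sumP-pointwise (suc L) _ i j))
    where
    series : ℕ → ℕ → ℕ → Coeffs
    series e n h = sumP n λ k →
      mono (sgn k * ιℤ (poch2 (+ 2 ℤ.- + e) (h ∸ k))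
              * invNat (dfact (e ∸ 1 ∸ 2 ℕ.* k) ℕ.* dfact (e ∸ 2 ℕ.* k) ℕ.* dfact (2 ℕ.* k)))
           (e ∸ 2 ℕ.* k) (2 ℕ.* k)
    unfold : f-m 1 1 (suc (2 ℕ.* L)) ≡ series (suc (2 ℕ.* L)) (suc L) L
    unfold = ≡.trans (≡.cong (λ e → series e (nTerms e 1) ((e ∸ 1) ℕ./ 2)) (eOf-odd L))
                     (≡.cong (λ h → series (suc (2 ℕ.* L)) (suc h) h) (2n/2≡n L))

  ⊖g-m≋antidiagonalᵀ : ∀ L → (⊖ g-m 1 1 (suc (2 ℕ.* L))) ≋ (antidiagonal L (θ-coeff L) ᵀ)
  ⊖g-m≋antidiagonalᵀ L i j = begin
    - g-m 1 1 d i j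
      ≈⟨ -‿cong (reflexive (≡.trans (≡.cong (λ p → p i j) unfold) (sumP-pointwise (suc L) _ i j))) ⟩
    - sumK (suc L) (λ k → mono (gcoeff k) (2 ℕ.* k) (d ∸ 2 ℕ.* k) i j)
      ≈⟨ sumK-neg (suc L) _ ⟨
    sumK (suc L) (λ k → - mono (gcoeff k) (2 ℕ.* k) (d ∸ 2 ℕ.* k) i j)
      ≈⟨ sumK-cong (suc L) (λ k _ → trans (sym (mono-neg (gcoeff k) (2 ℕ.* k) (d ∸ 2 ℕ.* k) i j)) (mono-cong (2 ℕ.* k) (d ∸ 2 ℕ.* k) i j (-gcoeff≈θ-coeff k))) ⟩
    sumK (suc L) (λ k → mono (θ-coeff L k) (2 ℕ.* k) (d ∸ 2 ℕ.* k) i j)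
      ≈⟨ sumK-cong (suc L) (λ k _ → reflexive (mono-transpose (θ-coeff L k) (2 ℕ.* k) (d ∸ 2 ℕ.* k) i j)) ⟩
    antidiagonal L (θ-coeff L) j i
      ∎
    where
    d : ℕ
    d = suc (2 ℕ.* L)
    numerator denominator gcoeff : ℕ → Carrier
    numerator k = ιℤ (poch2 (+ 2 ℤ.- + d) (L ∸ k))
    denominator k = invNat (dfact (d ∸ 1 ∸ 2 ℕ.* k) ℕ.* dfact (d ∸ 2 ℕ.* k) ℕ.* dfact (2 ℕ.* k))
    gcoeff k = sgn (k ℕ.+ d) * numerator k * denominator k
    series : ℕ → ℕ → ℕ → Coeffs
    series e n h = sumP n λ k →
      mono (sgn (k ℕ.+ d) * ιℤ (poch2 (+ 2 ℤ.- + e) (h ∸ k))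
              * invNat (dfact (e ∸ 1 ∸ 2 ℕ.* k) ℕ.* dfact (e ∸ 2 ℕ.* k) ℕ.* dfact (2 ℕ.* k)))
           (2 ℕ.* k) (e ∸ 2 ℕ.* k)
    unfold : g-m 1 1 d ≡ series d (suc L) L
    unfold = ≡.trans (≡.cong (λ e → series e (nTerms e 1) ((e ∸ 1) ℕ./ 2)) (eOf-odd L))
                     (≡.cong (λ h → series d (suc h) h) (2n/2≡n L))
    -gcoeff≈θ-coeff : ∀ k → - gcoeff k ≈ θ-coeff L k
    -gcoeff≈θ-coeff k = begin
      - (sgn (k ℕ.+ d) * numerator k * denominator k)
        ≈⟨ -‿distribˡ-* _ _ ⟩
      - (sgn (k ℕ.+ d) * numerator k) * denominator k
        ≈⟨ *-cong (-‿distribˡ-* _ _) refl ⟩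
      - sgn (k ℕ.+ d) * numerator k * denominator k
        ≈⟨ *-cong (*-cong -sgn[k+d]≈sgn[k] refl) refl ⟩
      sgn k * numerator k * denominator k
        ∎
      where
      -sgn[k+d]≈sgn[k] : - sgn (k ℕ.+ d) ≈ sgn k
      -sgn[k+d]≈sgn[k] = begin
        - sgn (k ℕ.+ d)      ≈⟨ -‿cong (sgn-+ k d) ⟩
        - (sgn k * sgn d)    ≈⟨ -‿cong (*-cong refl (sgn-odd L)) ⟩
        - (sgn k * - 1#)     ≈⟨ -‿cong (-‿distribʳ-* _ _) ⟨
        - - (sgn k * 1#)     ≈⟨ -‿involutive _ ⟩
        sgn k * 1#           ≈⟨ *-identityʳ _ ⟩
        sgn k                ∎

  module _ (L : ℕ) where

    private
      d : ℕ
      d = suc (2 ℕ.* L)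
      A : Coeffs
      A = antidiagonal L (θ-coeff L)
      s : Carrier
      s = θ-scale L

    antidiagonal-binomial : ∀ r k → r ℕ.+ k ≡ L → A (suc (2 ℕ.* r)) (2 ℕ.* k) ≈ ι (binomial₂ d (suc (2 ℕ.* r)) (2 ℕ.* k)) * s
    antidiagonal-binomial r k r+k≡L = trans (antidiagonal-oddˣ-evenʸ _ r k r+k≡L) (θ-coeff-binomial r k r+k≡L)

    antidiagonalᵀ-binomial : ∀ r k → r ℕ.+ k ≡ L → A (suc (2 ℕ.* k)) (2 ℕ.* r) ≈ ι (binomial₂ d (2 ℕ.* r) (suc (2 ℕ.* k))) * s
    antidiagonalᵀ-binomial r k r+k≡L =
      trans (antidiagonal-binomial k r (≡.trans (ℕ.+-comm k r) r+k≡L))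
            (*-cong (reflexive (≡.cong ι (binomial₂-comm d (suc (2 ℕ.* k)) (2 ℕ.* r)))) refl)

    ι-binomial₂-offDegree : ∀ {a b} → a ℕ.+ b ≢ d → ι (binomial₂ d a b) ≈ 0#
    ι-binomial₂-offDegree {a} {b} a+b≢d = reflexive (≡.cong ι (binomial₂-offDegree d a b a+b≢d))

    antidiagonal⊖ᵀ : (A ⊖ (A ᵀ)) ≋ (((X ⊖ Y) ^P d) ⊛ mono s 0 0)
    antidiagonal⊖ᵀ a b = begin
      A a b + - A b a                   ≈⟨ difference (oddDegreeShape L a b) ⟩
      sgn b * ι (binomial₂ d a b) * s   ≈⟨ *-cong ([X⊖Y]^P≋±binomial₂ d a b) refl ⟨
      ((X ⊖ Y) ^P d) a b * s            ≈⟨ ⊛-constʳ _ s a b ⟨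
      (((X ⊖ Y) ^P d) ⊛ mono s 0 0) a b ∎
      where
      difference : ∀ {a b} → OddDegreeShape L a b → A a b + - A b a ≈ sgn b * ι (binomial₂ d a b) * s
      difference (oddEven r k r+k≡L) = begin
        A (suc (2 ℕ.* r)) (2 ℕ.* k) + - A (2 ℕ.* k) (suc (2 ℕ.* r))
          ≈⟨ +-cong (antidiagonal-binomial r k r+k≡L) (trans (-‿cong (antidiagonal-evenˣ L _ k _)) -0#≈0#) ⟩
        ι B * s + 0#
          ≈⟨ +-identityʳ _ ⟩
        ι B * s
          ≈⟨ *-cong (trans (*-cong (sgn-even k) refl) (*-identityˡ _)) refl ⟨
        sgn (2 ℕ.* k) * ι B * s
          ∎
        where B = binomial₂ d (suc (2 ℕ.* r)) (2 ℕ.* k)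
      difference (evenOdd r k r+k≡L) = begin
        A (2 ℕ.* r) (suc (2 ℕ.* k)) + - A (suc (2 ℕ.* k)) (2 ℕ.* r)
          ≈⟨ +-cong (antidiagonal-evenˣ L _ r _) (-‿cong (antidiagonalᵀ-binomial r k r+k≡L)) ⟩
        0# + - (ι B * s)
          ≈⟨ +-identityˡ _ ⟩
        - (ι B * s)
          ≈⟨ -‿distribˡ-* _ _ ⟩
        - ι B * s
          ≈⟨ *-cong (trans (*-cong (sgn-odd k) refl) (-1*x≈-x _)) refl ⟨
        sgn (suc (2 ℕ.* k)) * ι B * s
          ∎
        where B = binomial₂ d (2 ℕ.* r) (suc (2 ℕ.* k))
      difference {a} {b} (offDegree a+b≢d) = begin
        A a b + - A b a
          ≈⟨ +-cong (antidiagonal-offDegree L _ a b a+b≢d)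
                    (trans (-‿cong (antidiagonal-offDegree L _ b a (a+b≢d ∘ ≡.trans (ℕ.+-comm a b)))) -0#≈0#) ⟩
        0# + 0#
          ≈⟨ +-identityʳ _ ⟩
        0#
          ≈⟨ trans (*-cong (trans (*-cong refl (ι-binomial₂-offDegree {a} {b} a+b≢d)) (zeroʳ _)) refl) (zeroˡ s) ⟨
        sgn b * ι (binomial₂ d a b) * s
          ∎

    antidiagonal⊕ᵀ : (A ⊕ (A ᵀ)) ≋ (((X ⊕ Y) ^P d) ⊛ mono s 0 0)
    antidiagonal⊕ᵀ a b = begin
      A a b + A b a                     ≈⟨ sum (oddDegreeShape L a b) ⟩
      ι (binomial₂ d a b) * s           ≈⟨ *-cong ([X⊕Y]^P≋binomial₂ d a b) refl ⟨
      ((X ⊕ Y) ^P d) a b * s            ≈⟨ ⊛-constʳ _ s a b ⟨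
      (((X ⊕ Y) ^P d) ⊛ mono s 0 0) a b ∎
      where
      sum : ∀ {a b} → OddDegreeShape L a b → A a b + A b a ≈ ι (binomial₂ d a b) * s
      sum (oddEven r k r+k≡L) =
        trans (+-cong (antidiagonal-binomial r k r+k≡L) (antidiagonal-evenˣ L _ k _)) (+-identityʳ _)
      sum (evenOdd r k r+k≡L) =
        trans (+-cong (antidiagonal-evenˣ L _ r _) (antidiagonalᵀ-binomial r k r+k≡L)) (+-identityˡ _)
      sum {a} {b} (offDegree a+b≢d) = begin
        A a b + A b a
          ≈⟨ +-cong (antidiagonal-offDegree L _ a b a+b≢d)
                    (antidiagonal-offDegree L _ b a (a+b≢d ∘ ≡.trans (ℕ.+-comm a b))) ⟩
        0# + 0#
          ≈⟨ +-identityʳ _ ⟩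
        0#
          ≈⟨ trans (*-cong (ι-binomial₂-offDegree {a} {b} a+b≢d) refl) (zeroˡ s) ⟨
        ι (binomial₂ d a b) * s
          ∎

    θ-m-odd-InD : InD (mvec 1 1 d d) (θ-m 1 1 d)
    θ-m-odd-InD =
      InD-1-1-d-d d s
        (IsPoly-≋ f≋A (antidiagonal-isPoly L _))
        (IsPoly-≋ -g≋Aᵀ (IsPoly-ᵀ (antidiagonal-isPoly L _)))
        (λ j → trans (f≋A 0 j) (antidiagonal-evenˣ L _ 0 j))
        (λ i → trans (-g≋Aᵀ i 0) (antidiagonal-evenˣ L _ 0 i))
        (≋-trans (⊕-cong f≋A (⊖-cong -g≋Aᵀ)) antidiagonal⊖ᵀ)
        (≋-trans (⊕-cong f≋A -g≋Aᵀ) antidiagonal⊕ᵀ)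
      where
      f≋A : f-m 1 1 d ≋ A
      f≋A = f-m≋antidiagonal L
      -g≋Aᵀ : (⊖ g-m 1 1 d) ≋ (A ᵀ)
      -g≋Aᵀ = ⊖g-m≋antidiagonalᵀ L

lemma4p2 : {c ℓ : Level} (K : CharZeroField c ℓ) (d : ℕ) → d % 2 ≡ 1 →
    Poly.InD K (Poly.mvec K 1 1 d d) (Poly.θ-m K 1 1 d)
lemma4p2 K d d%2≡1 =
  ≡.subst (λ d → Poly.InD K (Poly.mvec K 1 1 d d) (Poly.θ-m K 1 1 d))
          (≡.sym (Arithmetic.odd≡1+2[n/2] K d%2≡1))
          (θ-m-odd-InD K (d ℕ./ 2))
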